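{- Let $\alpha$ be an ordinal, $\theta$ an infinite ordinal, and $\bar a\neq\bar b\in(\theta^{\underline{\alpha}})_<$. Let $J_0=\{\beta<\alpha:a_\beta=b_\beta\}$, $J_+=\{\beta<\alpha:a_\beta<b_\beta\}$, $J_-=\{\beta<\alpha:b_\beta<a_\beta\}$, and let $R$ be the smallest convex equivalence relation on $\alpha$ containing $\{(\beta,\gamma):a_\beta=b_\gamma\}$, $\{(\beta,\gamma):a_\beta<a_\gamma\le b_\beta\}$ and $\{(\beta,\gamma):b_\beta<b_\gamma\le a_\beta\}$. Then: (1) for every $\beta\in J_0$, $[\beta]_R\subseteq J_0$; (2) for every $\beta\in J_+$, $[\beta]_R\subseteq J_+$; (3) for every $\beta\in J_-$, $[\beta]_R\subseteq J_-$. Moreover, $[\beta]_R=\{\beta\}$ for every $\beta\in J_0$.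
   Context: $(\theta^{\underline\alpha})_<$ is the set of strictly increasing sequences of length $\alpha$ of ordinals below $\theta$. A convex equivalence relation is one whose classes are convex subsets of $\alpha$. -}

module Defs where

open import Level using (0ℓ)
open import Data.Nat using (ℕ)
open import Data.Fin using (Fin)
open import Data.Product using (Σ; _×_)
open import Data.Sum using (_⊎_)
open import Relation.Nullary using (¬_)
open import Relation.Binary using (Rel; IsStrictTotalOrder; IsEquivalence)
open import Relation.Binary.PropositionalEquality using (_≡_)
open import Induction.WellFounded using (WellFounded)
open import Function.Bundles using (_↔_)

-- An ordinal, represented (up to isomorphism) by a well-ordered set:
-- a strict total order (w.r.t. ≡) that is well-founded.
record Ordinal : Set₁ where
  field
    Carrier : Set
    _<_     : Rel Carrier 0ℓ
    isSTO   : IsStrictTotalOrder _≡_ _<_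
    wf      : WellFounded _<_

open Ordinal public

Le : (o : Ordinal) → Carrier o → Carrier o → Set
Le o x y = (_<_ o x y) ⊎ (x ≡ y)

Infinite : Ordinal → Set
Infinite θ = ¬ Σ ℕ (λ n → Carrier θ ↔ Fin n)

StrictlyIncreasing : (α θ : Ordinal) → (Carrier α → Carrier θ) → Set
StrictlyIncreasing α θ a = ∀ β γ → _<_ α β γ → _<_ θ (a β) (a γ)

module _ (α θ : Ordinal) (a b : Carrier α → Carrier θ) where

  J₀ J₊ J₋ : Carrier α → Set
  J₀ β = a β ≡ b β
  J₊ β = _<_ θ (a β) (b β)
  J₋ β = _<_ θ (b β) (a β)

  IsConvexEquivalence : Rel (Carrier α) 0ℓ → Set
  IsConvexEquivalence E =
    IsEquivalence E ×
    (∀ β δ γ → E β γ → _<_ α β δ → _<_ α δ γ → E β δ)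

  ContainsGenerators : Rel (Carrier α) 0ℓ → Set
  ContainsGenerators E =
    (∀ β γ → a β ≡ b γ → E β γ) ×
    (∀ β γ → _<_ θ (a β) (a γ) → Le θ (a γ) (b β) → E β γ) ×
    (∀ β γ → _<_ θ (b β) (b γ) → Le θ (b γ) (a β) → E β γ)

  -- R : the smallest convex equivalence relation containing the generators
  -- (intersection of all such relations)
  R : Carrier α → Carrier α → Set₁
  R β γ = (E : Rel (Carrier α) 0ℓ) → IsConvexEquivalence E →
          ContainsGenerators E → E β γ

{-# OPTIONS --safe #-}
-- The relation "β = γ, or a < b throughout the segment between β and γ, or b < a
-- throughout it" is a convex equivalence relation containing the three generating
-- sets: an equality a β = b γ with β < γ forces b < a on [β, γ] by monotonicity,
-- and a β < a γ ≤ b β forces a < b on [β, γ].  Hence R is contained in it, and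
-- its classes lie inside J₊, inside J₋, or are singletons in J₀.
module Submission where

open import Level using (0ℓ)
open import Data.Product using (_×_; _,_; proj₁)
open import Data.Sum using (_⊎_; inj₁; inj₂; swap)
open import Function using (_∘′_)
open import Data.Empty using (⊥-elim)
open import Relation.Nullary using (¬_)
open import Relation.Unary using (Pred; _⊥_)
open import Relation.Binary using (Rel; IsStrictTotalOrder; IsEquivalence; tri<; tri≈; tri>)
open import Relation.Binary.PropositionalEquality using (_≡_; refl; sym; subst)
import Relation.Binary.Construct.StrictToNonStrict as StrictToNonStrict

open import Defs

module Segments {A : Set} {_<_ : Rel A 0ℓ} (sto : IsStrictTotalOrder _≡_ _<_) where
  open IsStrictTotalOrder sto public using (compare; asym)
  open IsStrictTotalOrder sto using (trans; irrefl; isEquivalence; <-resp-≈; <-respˡ-≈; <-respʳ-≈)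
  open StrictToNonStrict _≡_ _<_ using (_≤_)

  <-irrefl : ∀ {x} → ¬ (x < x)
  <-irrefl = irrefl refl

  <-≤-trans : ∀ {x y z} → x < y → y ≤ z → x < z
  <-≤-trans = StrictToNonStrict.<-≤-trans _≡_ _<_ trans <-respʳ-≈

  ≤-<-trans : ∀ {x y z} → x ≤ y → y < z → x < z
  ≤-<-trans = StrictToNonStrict.≤-<-trans _≡_ _<_ sym trans <-respˡ-≈

  ≤-trans : ∀ {x y z} → x ≤ y → y ≤ z → x ≤ z
  ≤-trans = StrictToNonStrict.trans _≡_ _<_ isEquivalence <-resp-≈ trans

  Between : A → A → A → Set
  Between β δ γ = (β ≤ δ × δ ≤ γ) ⊎ (γ ≤ δ × δ ≤ β)

  AllBetween : Pred A 0ℓ → Rel A 0ℓ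
  AllBetween P β γ = ∀ δ → Between β δ γ → P δ

  between-sym : ∀ {β δ γ} → Between β δ γ → Between γ δ β
  between-sym = swap

  between-right : ∀ β γ → Between β γ γ
  between-right β γ with compare β γ
  ... | tri< β<γ _ _ = inj₁ (inj₁ β<γ , inj₂ refl)
  ... | tri≈ _ β≡γ _ = inj₁ (inj₂ β≡γ , inj₂ refl)
  ... | tri> _ _ γ<β = inj₂ (inj₂ refl , inj₁ γ<β)

  between-left : ∀ β γ → Between β β γ
  between-left β γ = between-sym (between-right γ β)

  allBetween-sym : ∀ {P β γ} → AllBetween P β γ → AllBetween P γ β
  allBetween-sym all δ = all δ ∘′ between-sym

  allBetween-trans : ∀ {P β γ ε} → AllBetween P β γ → AllBetween P γ ε → AllBetween P β ε
  allBetween-trans {γ = γ} βγ γε δ (inj₁ (β≤δ , δ≤ε)) with compare δ γ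
  ... | tri< δ<γ _ _ = βγ δ (inj₁ (β≤δ , inj₁ δ<γ))
  ... | tri≈ _ δ≡γ _ = βγ δ (inj₁ (β≤δ , inj₂ δ≡γ))
  ... | tri> _ _ γ<δ = γε δ (inj₁ (inj₁ γ<δ , δ≤ε))
  allBetween-trans {γ = γ} βγ γε δ (inj₂ (ε≤δ , δ≤β)) with compare δ γ
  ... | tri< δ<γ _ _ = γε δ (inj₂ (ε≤δ , inj₁ δ<γ))
  ... | tri≈ _ δ≡γ _ = βγ δ (inj₂ (inj₂ (sym δ≡γ) , δ≤β))
  ... | tri> _ _ γ<δ = βγ δ (inj₂ (inj₁ γ<δ , δ≤β))

  allBetween-shrink : ∀ {P β δ γ} → AllBetween P β γ → β < δ → δ < γ → AllBetween P β δ
  allBetween-shrink all β<δ δ<γ x (inj₁ (β≤x , x≤δ)) = all x (inj₁ (β≤x , ≤-trans x≤δ (inj₁ δ<γ)))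
  allBetween-shrink all β<δ δ<γ x (inj₂ (δ≤x , x≤β)) = ⊥-elim (<-irrefl (≤-<-trans (≤-trans δ≤x x≤β) β<δ))

  SameBlock : Pred A 0ℓ → Pred A 0ℓ → Rel A 0ℓ
  SameBlock P Q β γ = β ≡ γ ⊎ AllBetween P β γ ⊎ AllBetween Q β γ

  module _ {P Q : Pred A 0ℓ} where

    sameBlock-isEquivalence : P ⊥ Q → IsEquivalence (SameBlock P Q)
    sameBlock-isEquivalence P⊥Q = record { refl = inj₁ refl ; sym = sameBlock-sym ; trans = sameBlock-trans }
      where
      sameBlock-sym : ∀ {β γ} → SameBlock P Q β γ → SameBlock P Q γ β
      sameBlock-sym (inj₁ β≡γ) = inj₁ (sym β≡γ)
      sameBlock-sym (inj₂ (inj₁ all)) = inj₂ (inj₁ (allBetween-sym all))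
      sameBlock-sym (inj₂ (inj₂ all)) = inj₂ (inj₂ (allBetween-sym all))

      sameBlock-trans : ∀ {β γ ε} → SameBlock P Q β γ → SameBlock P Q γ ε → SameBlock P Q β ε
      sameBlock-trans (inj₁ refl) γε = γε
      sameBlock-trans βγ (inj₁ refl) = βγ
      sameBlock-trans (inj₂ (inj₁ βγ)) (inj₂ (inj₁ γε)) = inj₂ (inj₁ (allBetween-trans βγ γε))
      sameBlock-trans (inj₂ (inj₂ βγ)) (inj₂ (inj₂ γε)) = inj₂ (inj₂ (allBetween-trans βγ γε))
      sameBlock-trans {β} {γ} {ε} (inj₂ (inj₁ βγ)) (inj₂ (inj₂ γε)) =
        ⊥-elim (P⊥Q (βγ γ (between-right β γ) , γε γ (between-left γ ε)))
      sameBlock-trans {β} {γ} {ε} (inj₂ (inj₂ βγ)) (inj₂ (inj₁ γε)) =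
        ⊥-elim (P⊥Q (γε γ (between-left γ ε) , βγ γ (between-right β γ)))

    sameBlock-convex : ∀ β δ γ → SameBlock P Q β γ → β < δ → δ < γ → SameBlock P Q β δ
    sameBlock-convex β δ γ (inj₁ refl) β<δ δ<γ = ⊥-elim (asym β<δ δ<γ)
    sameBlock-convex β δ γ (inj₂ (inj₁ all)) β<δ δ<γ = inj₂ (inj₁ (allBetween-shrink all β<δ δ<γ))
    sameBlock-convex β δ γ (inj₂ (inj₂ all)) β<δ δ<γ = inj₂ (inj₂ (allBetween-shrink all β<δ δ<γ))

    sameBlock-stableˡ : P ⊥ Q → ∀ {β γ} → P β → SameBlock P Q β γ → P γ
    sameBlock-stableˡ P⊥Q Pβ (inj₁ refl) = Pβ
    sameBlock-stableˡ P⊥Q {β} {γ} Pβ (inj₂ (inj₁ all)) = all γ (between-right β γ)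
    sameBlock-stableˡ P⊥Q {β} {γ} Pβ (inj₂ (inj₂ all)) = ⊥-elim (P⊥Q (Pβ , all β (between-left β γ)))

    sameBlock-stableʳ : P ⊥ Q → ∀ {β γ} → Q β → SameBlock P Q β γ → Q γ
    sameBlock-stableʳ P⊥Q Qβ (inj₁ refl) = Qβ
    sameBlock-stableʳ P⊥Q {β} {γ} Qβ (inj₂ (inj₁ all)) = ⊥-elim (P⊥Q (all β (between-left β γ) , Qβ))
    sameBlock-stableʳ P⊥Q {β} {γ} Qβ (inj₂ (inj₂ all)) = all γ (between-right β γ)

    sameBlock-singleton : ∀ {β γ} → ¬ P β → ¬ Q β → SameBlock P Q β γ → γ ≡ β
    sameBlock-singleton ¬Pβ ¬Qβ (inj₁ β≡γ) = sym β≡γ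
    sameBlock-singleton {β} {γ} ¬Pβ ¬Qβ (inj₂ (inj₁ all)) = ⊥-elim (¬Pβ (all β (between-left β γ)))
    sameBlock-singleton {β} {γ} ¬Pβ ¬Qβ (inj₂ (inj₂ all)) = ⊥-elim (¬Qβ (all β (between-left β γ)))

module Increasing (α θ : Ordinal) where
  open Segments (isSTO α) using (AllBetween; ≤-trans; ≤-<-trans; <-irrefl) renaming (compare to compareα)
  open Segments (isSTO θ) using ()
    renaming (≤-trans to ≤-transθ; ≤-<-trans to ≤-<-transθ; <-≤-trans to <-≤-transθ; <-irrefl to <-irreflθ; asym to asymθ)

  private
    _<α_ = _<_ α
    _<θ_ = _<_ θ

  module _ {h : Carrier α → Carrier θ} (h↑ : StrictlyIncreasing α θ h) where

    strictlyIncreasing⇒monotone : ∀ {x y} → Le α x y → Le θ (h x) (h y)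
    strictlyIncreasing⇒monotone (inj₁ x<y) = inj₁ (h↑ _ _ x<y)
    strictlyIncreasing⇒monotone (inj₂ refl) = inj₂ refl

    strictlyIncreasing⇒reflects-< : ∀ {x y} → h x <θ h y → x <α y
    strictlyIncreasing⇒reflects-< {x} {y} hx<hy with compareα x y
    ... | tri< x<y _ _ = x<y
    ... | tri≈ _ refl _ = ⊥-elim (<-irreflθ hx<hy)
    ... | tri> _ _ y<x = ⊥-elim (asymθ hx<hy (h↑ _ _ y<x))

  module _ {f g : Carrier α → Carrier θ} (f↑ : StrictlyIncreasing α θ f) (g↑ : StrictlyIncreasing α θ g) where

    ≡⇒allBetween-g<f : ∀ {β γ} → f β ≡ g γ → β <α γ → AllBetween (λ δ → g δ <θ f δ) β γ
    ≡⇒allBetween-g<f fβ≡gγ β<γ δ (inj₁ (inj₁ β<δ , δ≤γ)) =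
      ≤-<-transθ (strictlyIncreasing⇒monotone g↑ δ≤γ) (subst (_<θ f δ) fβ≡gγ (f↑ _ _ β<δ))
    ≡⇒allBetween-g<f fβ≡gγ β<γ δ (inj₁ (inj₂ refl , δ≤γ)) = subst (g δ <θ_) (sym fβ≡gγ) (g↑ _ _ β<γ)
    ≡⇒allBetween-g<f fβ≡gγ β<γ δ (inj₂ (γ≤δ , δ≤β)) = ⊥-elim (<-irrefl (≤-<-trans (≤-trans γ≤δ δ≤β) β<γ))

    <≤⇒allBetween-f<g : ∀ {β γ} → f β <θ f γ → Le θ (f γ) (g β) → AllBetween (λ δ → f δ <θ g δ) β γ
    <≤⇒allBetween-f<g fβ<fγ fγ≤gβ δ (inj₁ (inj₁ β<δ , δ≤γ)) =
      ≤-<-transθ (≤-transθ (strictlyIncreasing⇒monotone f↑ δ≤γ) fγ≤gβ) (g↑ _ _ β<δ)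
    <≤⇒allBetween-f<g fβ<fγ fγ≤gβ δ (inj₁ (inj₂ refl , δ≤γ)) = <-≤-transθ fβ<fγ fγ≤gβ
    <≤⇒allBetween-f<g fβ<fγ fγ≤gβ δ (inj₂ (γ≤δ , δ≤β)) =
      ⊥-elim (<-irrefl (≤-<-trans (≤-trans γ≤δ δ≤β) (strictlyIncreasing⇒reflects-< f↑ fβ<fγ)))

module SignBlocks (α θ : Ordinal) (a b : Carrier α → Carrier θ) where
  open Segments (isSTO α)
  open Increasing α θ
  open IsStrictTotalOrder (isSTO θ) using () renaming (asym to <θ-asym)

  J₊⊥J₋ : J₊ α θ a b ⊥ J₋ α θ a b
  J₊⊥J₋ (ab , ba) = <θ-asym ab ba

  SameSign : Rel (Carrier α) 0ℓ
  SameSign = SameBlock (J₊ α θ a b) (J₋ α θ a b)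

  R-refl : ∀ β → R α θ a b β β
  R-refl β E E-isConvexEquivalence _ = IsEquivalence.refl (proj₁ E-isConvexEquivalence)

  module _ (a↑ : StrictlyIncreasing α θ a) (b↑ : StrictlyIncreasing α θ b) where

    sameSign-isConvexEquivalence : IsConvexEquivalence α θ a b SameSign
    sameSign-isConvexEquivalence = sameBlock-isEquivalence J₊⊥J₋ , sameBlock-convex

    sameSign-containsGenerators : ContainsGenerators α θ a b SameSign
    sameSign-containsGenerators = equal , a-overtaken , b-overtaken
      where
      equal : ∀ β γ → a β ≡ b γ → SameSign β γ
      equal β γ aβ≡bγ with compare β γ
      ... | tri< β<γ _ _ = inj₂ (inj₂ (≡⇒allBetween-g<f a↑ b↑ aβ≡bγ β<γ))
      ... | tri≈ _ β≡γ _ = inj₁ β≡γ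
      ... | tri> _ _ γ<β = inj₂ (inj₁ (allBetween-sym (≡⇒allBetween-g<f b↑ a↑ (sym aβ≡bγ) γ<β)))

      a-overtaken : ∀ β γ → _<_ θ (a β) (a γ) → Le θ (a γ) (b β) → SameSign β γ
      a-overtaken β γ aβ<aγ aγ≤bβ = inj₂ (inj₁ (<≤⇒allBetween-f<g a↑ b↑ aβ<aγ aγ≤bβ))

      b-overtaken : ∀ β γ → _<_ θ (b β) (b γ) → Le θ (b γ) (a β) → SameSign β γ
      b-overtaken β γ bβ<bγ bγ≤aβ = inj₂ (inj₂ (<≤⇒allBetween-f<g b↑ a↑ bβ<bγ bγ≤aβ))

    R⇒sameSign : ∀ {β γ} → R α θ a b β γ → SameSign β γ
    R⇒sameSign βRγ = βRγ SameSign sameSign-isConvexEquivalence sameSign-containsGenerators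

lemma4p10 : (α θ : Ordinal) → Infinite θ →
    (a b : Carrier α → Carrier θ) →
    StrictlyIncreasing α θ a → StrictlyIncreasing α θ b →
    ¬ (∀ β → a β ≡ b β) →
    (∀ β → J₀ α θ a b β → ∀ γ → R α θ a b β γ → J₀ α θ a b γ) ×
    (∀ β → J₊ α θ a b β → ∀ γ → R α θ a b β γ → J₊ α θ a b γ) ×
    (∀ β → J₋ α θ a b β → ∀ γ → R α θ a b β γ → J₋ α θ a b γ) ×
    (∀ β → J₀ α θ a b β → R α θ a b β β × (∀ γ → R α θ a b β γ → γ ≡ β))
lemma4p10 α θ _ a b a↑ b↑ _ =
  (λ β aβ≡bβ γ βRγ → subst (J₀ α θ a b) (sym (J₀-singleton aβ≡bβ βRγ)) aβ≡bβ) ,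
  (λ β β∈J₊ γ βRγ → sameBlock-stableˡ J₊⊥J₋ β∈J₊ (R⇒sameSign a↑ b↑ βRγ)) ,
  (λ β β∈J₋ γ βRγ → sameBlock-stableʳ J₊⊥J₋ β∈J₋ (R⇒sameSign a↑ b↑ βRγ)) ,
  (λ β aβ≡bβ → R-refl β , λ γ → J₀-singleton aβ≡bβ)
  where
  open Segments (isSTO α) using (sameBlock-stableˡ; sameBlock-stableʳ; sameBlock-singleton)
  open SignBlocks α θ a b
  open IsStrictTotalOrder (isSTO θ) using (irrefl)

  J₀-singleton : ∀ {β γ} → J₀ α θ a b β → R α θ a b β γ → γ ≡ β
  J₀-singleton aβ≡bβ βRγ = sameBlock-singleton (irrefl aβ≡bβ) (irrefl (sym aβ≡bβ)) (R⇒sameSign a↑ b↑ βRγ)
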